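{- Let $G=([m]\cup[n],E)$ be a domination graph, $w\ge 0$, and consider the compatibility graph defined by $G$. If $X\subseteq\{0,1\}^m$ is a bad set, then there exists a d-closed bad set $X'\subseteq\{0,1\}^m$ with $|X'|=|X|$.
   Context: For $y \in \{0,1\}^n$, $\mathrm{wt}(y)$ is the number of nonzero coordinates, and $\mathcal{B}(n,w)=\{y\in\{0,1\}^n : \mathrm{wt}(y)\le w\}$. A domination graph is a bipartite graph $G=([m]\cup[n],E)$ with left vertex set $[m]$ and right vertex set $[n]$ having no isolated right vertices. The compatibility graph defined by $G$ is the bipartite graph on $\{0,1\}^m\cup\mathcal{B}(n,w)$ in which $x\in\{0,1\}^m$ is adjacent to $y\in\mathcal{B}(n,w)$ iff for every $(i,j)\in E$, $x_i=0$ implies $y_j=0$. For $X\subseteq\{0,1\}^m$, $N(X)\subseteq\mathcal{B}(n,w)$ is the set of vertices adjacent to some element of $X$; $X$ is bad if $|N(X)|<|X|$. For $u,v\in\{0,1\}^m$, write $v\prec u$ if $\mathrm{supp}(v)\subseteq\mathrm{supp}(u)$. A set $X$ is descendant-closed (d-closed) if $u\in X$ and $v\prec u$ imply $v\in X$. -}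

module Defs where

open import Data.Bool using (Bool; true; false; T)
open import Data.Bool.Properties using (T?)
open import Data.Bool.Properties using () renaming (_≟_ to _≟ᵇ_)
open import Data.Nat using (ℕ; zero; suc; _≤_; _<_; _≤?_)
open import Data.Fin using (Fin)
open import Data.Fin.Properties using (all?)
open import Data.Vec using (Vec; []; _∷_; lookup)
open import Data.List using (List; []; _∷_; _++_; map; length; filter; allFin)
open import Data.List.Relation.Unary.Any using (Any)
import Data.List.Relation.Unary.Any as Any
open import Data.Product using (_×_; ∃; _,_)
open import Relation.Nullary using (Dec; yes; no; ¬_)
open import Relation.Nullary.Decidable using (_×-dec_; _→-dec_)
open import Relation.Binary.PropositionalEquality using (_≡_)

-- A domination graph: left vertices Fin m, right vertices Fin n,
-- edge relation E, with no isolated right vertex.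
NoIsolatedRight : ∀ {m n} → (Fin m → Fin n → Bool) → Set
NoIsolatedRight {m} {n} E = ∀ (j : Fin n) → ∃ λ (i : Fin m) → E i j ≡ true

allVecs : (k : ℕ) → List (Vec Bool k)
allVecs zero = [] ∷ []
allVecs (suc k) = map (false ∷_) (allVecs k) ++ map (true ∷_) (allVecs k)

wt : ∀ {k} → Vec Bool k → ℕ
wt {k} y = length (filter (λ j → lookup y j ≟ᵇ true) (allFin k))

VSubset : ℕ → Set
VSubset k = Vec Bool k → Bool

card : ∀ {k} → VSubset k → ℕ
card {k} X = length (filter (λ x → T? (X x)) (allVecs k))

-- Compatibility adjacency: x ∈ {0,1}^m adjacent to y iff for every edge (i,j),
-- x_i = 0 implies y_j = 0  (y is additionally required to lie in B(n,w)).
Compatible : ∀ {m n} → (Fin m → Fin n → Bool) → Vec Bool m → Vec Bool n → Set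
Compatible E x y = ∀ i j → E i j ≡ true → lookup x i ≡ false → lookup y j ≡ false

compatible? : ∀ {m n} (E : Fin m → Fin n → Bool) x y → Dec (Compatible E x y)
compatible? E x y = all? λ i → all? λ j →
  (E i j ≟ᵇ true) →-dec ((lookup x i ≟ᵇ false) →-dec (lookup y j ≟ᵇ false))

InNeighbourhood : ∀ {m n} → (Fin m → Fin n → Bool) → ℕ → VSubset m → Vec Bool n → Set
InNeighbourhood {m} E w X y =
  wt y ≤ w × Any (λ x → T (X x) × Compatible E x y) (allVecs m)

inNeighbourhood? : ∀ {m n} E w (X : VSubset m) (y : Vec Bool n) → Dec (InNeighbourhood E w X y)
inNeighbourhood? {m} E w X y =
  (wt y ≤? w) ×-dec Any.any? (λ x → T? (X x) ×-dec compatible? E x y) (allVecs m)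

cardN : ∀ {m n} → (Fin m → Fin n → Bool) → ℕ → VSubset m → ℕ
cardN {m} {n} E w X = length (filter (inNeighbourhood? E w X) (allVecs n))

Bad : ∀ {m n} → (Fin m → Fin n → Bool) → ℕ → VSubset m → Set
Bad E w X = cardN E w X < card X

_≺_ : ∀ {k} → Vec Bool k → Vec Bool k → Set
v ≺ u = ∀ i → lookup v i ≡ true → lookup u i ≡ true

DClosed : ∀ {k} → VSubset k → Set
DClosed X = ∀ u v → X u ≡ true → v ≺ u → X v ≡ true

-- Let X be bad and let ↓X be its downward closure: all v lying
-- below (v ≺ u) some u ∈ X.  Compatibility is monotone upwards: if v ≺ u
-- and v is adjacent to y, then so is u, since u has fewer zero coordinates
-- than v.  Hence every subset X′ ⊆ ↓X satisfies N(X′) ⊆ N(X).  It therefore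
-- suffices to find a d-closed X′ ⊆ ↓X with |X′| = |X| ≤ |↓X|; it is then
-- bad because |N(X′)| ≤ |N(X)| < |X| = |X′|.

module Submission where

open import Defs
open import Data.Bool using (Bool; true; false)
open import Data.Bool.Properties using (T?; T-≡) renaming (_≟_ to _≟ᵇ_)
open import Data.Nat using (ℕ; zero; suc; _+_; _∸_; _≤_; _≤?_; z≤n; s≤s)
open import Data.Nat.Properties
  using (≤-antisym; ≤-trans; +-identityʳ; m+[n∸m]≡n; m+n∸m≡n; ∸-monoˡ-≤; ≰⇒>; <⇒≤; module ≤-Reasoning)
open import Data.Fin using (Fin; zero; suc)
open import Data.Fin.Properties using (all?)
open import Data.Vec using (Vec; []; _∷_; lookup)
open import Data.List using (List; []; _∷_; map; length; filter)
open import Data.List.Properties using (length-++; filter-++)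
open import Data.List.Relation.Unary.Any using (here)
import Data.List.Relation.Unary.Any as Any
open import Data.List.Membership.Propositional using (_∈_; lose)
open import Data.List.Membership.Propositional.Properties using (∈-++⁺ˡ; ∈-++⁺ʳ; ∈-map⁺)
open import Data.List.Relation.Binary.Sublist.Propositional using (⊆-refl)
open import Data.List.Relation.Binary.Sublist.Propositional.Properties using (filter⁺; length-mono-≤)
open import Data.Product using (∃; _×_; _,_)
open import Function.Bundles using (Equivalence)
open import Relation.Nullary using (Dec; yes; no)
open import Relation.Nullary.Decidable using (⌊_⌋; _×-dec_; _→-dec_; toWitness; fromWitness)
open import Relation.Binary.PropositionalEquality using (_≡_; refl; sym; trans; cong; cong₂; subst)

open Equivalence using (to; from)

length-filter-mono : ∀ {A : Set} {P Q : A → Set} (P? : ∀ x → Dec (P x)) (Q? : ∀ x → Dec (Q x)) →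
                     (∀ x → P x → Q x) → (xs : List A) →
                     length (filter P? xs) ≤ length (filter Q? xs)
length-filter-mono P? Q? P⇒Q xs = length-mono-≤ (filter⁺ P? Q? (λ { refl → P⇒Q _ }) (⊆-refl {x = xs}))

length-filter-map : ∀ {A B : Set} {P : B → Set} (P? : ∀ x → Dec (P x)) (f : A → B) (xs : List A) →
                    length (filter P? (map f xs)) ≡ length (filter (λ x → P? (f x)) xs)
length-filter-map P? f [] = refl
length-filter-map P? f (x ∷ xs) with P? (f x)
... | yes _ = cong suc (length-filter-map P? f xs)
... | no _  = length-filter-map P? f xs

_⊑_ : ∀ {k} → VSubset k → VSubset k → Set
A ⊑ B = ∀ x → A x ≡ true → B x ≡ true

∅ : ∀ {k} → VSubset k
∅ _ = false

card-mono : ∀ {k} (A B : VSubset k) → A ⊑ B → card A ≤ card B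
card-mono {k} A B A⊑B = length-filter-mono (λ x → T? (A x)) (λ x → T? (B x))
  (λ x Ax → from T-≡ (A⊑B x (to T-≡ Ax))) (allVecs k)

card-∅ : ∀ k → card (∅ {k}) ≡ 0
card-∅ k = ≤-antisym (go (allVecs k)) z≤n
  where
  go : (xs : List (Vec Bool k)) → length (filter (λ x → T? (∅ x)) xs) ≤ 0
  go []       = z≤n
  go (_ ∷ xs) = go xs

slice₀ slice₁ : ∀ {k} → VSubset (suc k) → VSubset k
slice₀ D v = D (false ∷ v)
slice₁ D v = D (true ∷ v)

-- |D| = |D₀| + |D₁|, since allVecs (1+k) lists the 0-prefixed vectors first.
card-split : ∀ {k} (D : VSubset (suc k)) → card D ≡ card (slice₀ D) + card (slice₁ D)
card-split {k} D = trans (cong length (filter-++ D? vs₀ vs₁))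
  (trans (length-++ (filter D? vs₀))
         (cong₂ _+_ (length-filter-map D? (false ∷_) (allVecs k))
                    (length-filter-map D? (true ∷_) (allVecs k))))
  where
  D? = λ x → T? (D x)
  vs₀ = map (false ∷_) (allVecs k)
  vs₁ = map (true ∷_) (allVecs k)

glue : ∀ {k} → VSubset k → VSubset k → VSubset (suc k)
glue A B (false ∷ v) = A v
glue A B (true ∷ v)  = B v

allVecs-complete : ∀ {k} (v : Vec Bool k) → v ∈ allVecs k
allVecs-complete [] = here refl
allVecs-complete {suc k} (false ∷ v) = ∈-++⁺ˡ (∈-map⁺ (false ∷_) (allVecs-complete v))
allVecs-complete {suc k} (true ∷ v)  = ∈-++⁺ʳ (map (false ∷_) (allVecs k)) (∈-map⁺ (true ∷_) (allVecs-complete v))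

≺-refl : ∀ {k} (v : Vec Bool k) → v ≺ v
≺-refl v i p = p

≺-trans : ∀ {k} {a b c : Vec Bool k} → a ≺ b → b ≺ c → a ≺ c
≺-trans a≺b b≺c i aᵢ = b≺c i (a≺b i aᵢ)

≺-cons : ∀ {k b c} {v u : Vec Bool k} → (b ≡ true → c ≡ true) → v ≺ u → (b ∷ v) ≺ (c ∷ u)
≺-cons b⇒c v≺u zero    = b⇒c
≺-cons b⇒c v≺u (suc i) = v≺u i

≺-tail : ∀ {k b c} {v u : Vec Bool k} → (b ∷ v) ≺ (c ∷ u) → v ≺ u
≺-tail bv≺cu i = bv≺cu (suc i)

≺? : ∀ {k} (v u : Vec Bool k) → Dec (v ≺ u)
≺? v u = all? λ i → (lookup v i ≟ᵇ true) →-dec (lookup u i ≟ᵇ true)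

Dominated : ∀ {k} → VSubset k → Vec Bool k → Set
Dominated X v = ∃ λ u → X u ≡ true × v ≺ u

↓ : ∀ {k} → VSubset k → VSubset k
↓ {k} X v = ⌊ Any.any? (λ u → T? (X u) ×-dec ≺? v u) (allVecs k) ⌋

↓-sound : ∀ {k} (X : VSubset k) v → ↓ X v ≡ true → Dominated X v
↓-sound X v v∈↓X with Any.satisfied (toWitness (from T-≡ v∈↓X))
... | u , Xu , v≺u = u , to T-≡ Xu , v≺u

↓-complete : ∀ {k} (X : VSubset k) v → Dominated X v → ↓ X v ≡ true
↓-complete X v (u , Xu , v≺u) = to T-≡ (fromWitness (lose (allVecs-complete u) (from T-≡ Xu , v≺u)))

X⊑↓X : ∀ {k} (X : VSubset k) → X ⊑ ↓ X
X⊑↓X X v Xv = ↓-complete X v (v , Xv , ≺-refl v)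

↓-closed : ∀ {k} (X : VSubset k) → DClosed (↓ X)
↓-closed X u v u∈↓X v≺u with ↓-sound X u u∈↓X
... | x , Xx , u≺x = ↓-complete X v (x , Xx , ≺-trans {a = v} {u} {x} v≺u u≺x)

-- A vector with larger support has fewer zeros, hence fewer constraints.
compatible-up : ∀ {m n} (E : Fin m → Fin n → Bool) {v u : Vec Bool m} {y : Vec Bool n} →
                v ≺ u → Compatible E v y → Compatible E u y
compatible-up E {v} {u} v≺u v~y i j eᵢⱼ uᵢ≡0 = v~y i j eᵢⱼ (zero-down (v≺u i) uᵢ≡0)
  where
  zero-down : ∀ {a b : Bool} → (a ≡ true → b ≡ true) → b ≡ false → a ≡ false
  zero-down {false} _ _ = refl
  zero-down {true} a⇒b b≡0 with a⇒b refl | b≡0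
  ... | refl | ()

cardN-dominated : ∀ {m n} (E : Fin m → Fin n → Bool) (w : ℕ) (X′ X : VSubset m) →
                  (∀ x → X′ x ≡ true → Dominated X x) → cardN E w X′ ≤ cardN E w X
cardN-dominated {m} {n} E w X′ X dom =
  length-filter-mono (inNeighbourhood? E w X′) (inNeighbourhood? E w X) N⊆N (allVecs n)
  where
  N⊆N : ∀ y → InNeighbourhood E w X′ y → InNeighbourhood E w X y
  N⊆N y (wt≤w , adj) with Any.satisfied adj
  ... | x , X′x , x~y with dom x (to T-≡ X′x)
  ...   | u , Xu , x≺u = wt≤w , lose (allVecs-complete u) (from T-≡ Xu , compatible-up E {x} {u} {y} x≺u x~y)

slice₀-closed : ∀ {k} {D : VSubset (suc k)} → DClosed D → DClosed (slice₀ D)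
slice₀-closed cl u v Du v≺u = cl (false ∷ u) (false ∷ v) Du (≺-cons (λ b → b) v≺u)

slice₁-closed : ∀ {k} {D : VSubset (suc k)} → DClosed D → DClosed (slice₁ D)
slice₁-closed cl u v Du v≺u = cl (true ∷ u) (true ∷ v) Du (≺-cons (λ b → b) v≺u)

-- Flipping the first coordinate 1 ↦ 0 goes downwards, so D₁ ⊆ D₀.
slice₁⊑slice₀ : ∀ {k} {D : VSubset (suc k)} → DClosed D → slice₁ D ⊑ slice₀ D
slice₁⊑slice₀ cl x Dx = cl (true ∷ x) (false ∷ x) Dx (≺-cons (λ ()) (≺-refl x))

glue-closed : ∀ {k} {A B : VSubset k} → DClosed A → DClosed B → B ⊑ A → DClosed (glue A B)
glue-closed clA clB B⊑A (false ∷ u) (false ∷ v) Au v≺u = clA u v Au (≺-tail v≺u)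
glue-closed clA clB B⊑A (false ∷ u) (true ∷ v)  Au v≺u with v≺u zero refl
... | ()
glue-closed clA clB B⊑A (true ∷ u)  (false ∷ v) Bu v≺u = clA u v (B⊑A u Bu) (≺-tail v≺u)
glue-closed clA clB B⊑A (true ∷ u)  (true ∷ v)  Bu v≺u = clB u v Bu (≺-tail v≺u)

glue-⊑ : ∀ {k} {A B : VSubset k} {D : VSubset (suc k)} → A ⊑ slice₀ D → B ⊑ slice₁ D → glue A B ⊑ D
glue-⊑ A⊑D₀ B⊑D₁ (false ∷ x) = A⊑D₀ x
glue-⊑ A⊑D₀ B⊑D₁ (true ∷ x)  = B⊑D₁ x

ClosedSubsetOfSize : ∀ {m} → VSubset m → ℕ → Set
ClosedSubsetOfSize D k = ∃ λ D′ → DClosed D′ × D′ ⊑ D × card D′ ≡ k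

-- Take a d-closed subset inside D₀ if k ≤ |D₀|, and otherwise all of D₀
-- together with a d-closed subset of D₁ of size k - |D₀|; D₁ ⊆ D₀ keeps the
-- glued set d-closed.
closed-subsets : ∀ m (D : VSubset m) → DClosed D → ∀ k → k ≤ card D → ClosedSubsetOfSize D k
closed-subsets zero D cl zero _ = ∅ , (λ _ _ ()) , (λ _ ()) , refl
closed-subsets zero D cl (suc k) k<|D| = D , cl , (λ _ Dx → Dx) , ≤-antisym |D|≤1+k k<|D|
  where
  |D|≤1+k : card D ≤ suc k
  |D|≤1+k = ≤-trans (card-mono D (λ _ → true) (λ _ _ → refl)) (s≤s z≤n)
closed-subsets (suc m) D cl k k≤|D| with k ≤? card (slice₀ D)
... | yes k≤|D₀| with closed-subsets m (slice₀ D) (slice₀-closed cl) k k≤|D₀|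
...   | A , clA , A⊑D₀ , |A|≡k =
  glue A ∅ , glue-closed clA (λ _ _ ()) (λ _ ()) , glue-⊑ A⊑D₀ (λ _ ()) ,
  trans (card-split (glue A ∅)) (trans (cong₂ _+_ |A|≡k (card-∅ m)) (+-identityʳ k))
closed-subsets (suc m) D cl k k≤|D| | no k≰|D₀|
  with closed-subsets m (slice₁ D) (slice₁-closed cl) (k ∸ card (slice₀ D)) rest≤|D₁|
  where
  rest≤|D₁| : k ∸ card (slice₀ D) ≤ card (slice₁ D)
  rest≤|D₁| = subst (k ∸ card (slice₀ D) ≤_) (m+n∸m≡n (card (slice₀ D)) (card (slice₁ D)))
                (∸-monoˡ-≤ (card (slice₀ D)) (subst (k ≤_) (card-split D) k≤|D|))
... | B , clB , B⊑D₁ , |B|≡rest =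
  glue (slice₀ D) B ,
  glue-closed (slice₀-closed cl) clB (λ x Bx → slice₁⊑slice₀ cl x (B⊑D₁ x Bx)) ,
  glue-⊑ (λ _ Dx → Dx) B⊑D₁ ,
  trans (card-split (glue (slice₀ D) B))
        (trans (cong (card (slice₀ D) +_) |B|≡rest) (m+[n∸m]≡n (<⇒≤ (≰⇒> k≰|D₀|))))

lemma22 : (m n : ℕ) (E : Fin m → Fin n → Bool) → NoIsolatedRight E →
    (w : ℕ) (X : VSubset m) → Bad E w X →
    ∃ λ (X′ : VSubset m) → DClosed X′ × Bad E w X′ × card X′ ≡ card X
lemma22 m n E _ w X bad
  with closed-subsets m (↓ X) (↓-closed X) (card X) (card-mono X (↓ X) (X⊑↓X X))
... | X′ , X′-closed , X′⊑↓X , |X′|≡|X| = X′ , X′-closed , X′-bad , |X′|≡|X|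
  where
  open ≤-Reasoning
  X′-bad : Bad E w X′
  X′-bad = begin-strict
    cardN E w X′ ≤⟨ cardN-dominated E w X′ X (λ x X′x → ↓-sound X x (X′⊑↓X x X′x)) ⟩
    cardN E w X  <⟨ bad ⟩
    card X       ≡⟨ sym |X′|≡|X| ⟩
    card X′      ∎
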